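{- Let $G$ be a planar graph with maximum degree at most four that has no packing $(1,2^{10})$-coloring, chosen with $|V(G)|+|E(G)|$ minimum among all such graphs. Then no two vertices of degree $3$ in $G$ are adjacent.
   Context: A set of vertices is $i$-independent if any two distinct vertices in it are at distance at least $i+1$. A packing $(1,2^{10})$-coloring of $G$ is a partition of $V(G)$ into one independent set and ten $2$-independent sets. -}

module Defs where

open import Data.Nat using (ℕ; zero; suc; _+_; _≤_; _<_)
open import Data.Fin using (Fin; toℕ)
open import Data.Bool using (Bool; true; false; T; _∧_; if_then_else_)
open import Data.List using (List; []; _∷_; _++_; map; allFin)
open import Data.Nat.ListAction using (sum)
open import Data.Product using (Σ; ∃; _×_; _,_; proj₁; proj₂)
open import Data.Sum using (_⊎_)
open import Data.Empty using (⊥)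
open import Data.Rational using (ℚ; 0ℚ; 1ℚ) renaming (_+_ to _+ℚ_; _*_ to _*ℚ_; _-_ to _-ℚ_; _≤_ to _≤ℚ_)
open import Relation.Nullary using (¬_)
open import Relation.Binary.PropositionalEquality using (_≡_; _≢_)

record Graph (n : ℕ) : Set where
  field
    adj    : Fin n → Fin n → Bool
    sym    : ∀ u v → adj u v ≡ adj v u
    irrefl : ∀ u → adj u u ≡ false

open Graph public

b2n : Bool → ℕ
b2n true  = 1
b2n false = 0

deg : ∀ {n} → Graph n → Fin n → ℕ
deg {n} G u = sum (map (λ v → b2n (adj G u v)) (allFin n))

_<ᵇF_ : ∀ {n} → Fin n → Fin n → Bool
u <ᵇF v = toℕ u Data.Nat.<ᵇ toℕ v

numEdges : ∀ {n} → Graph n → ℕ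
numEdges {n} G =
  sum (map (λ u → sum (map (λ v → b2n (adj G u v ∧ (u <ᵇF v))) (allFin n))) (allFin n))

size : ∀ {n} → Graph n → ℕ
size {n} G = n + numEdges G

MaxDegreeAtMost : ∀ {n} → Graph n → ℕ → Set
MaxDegreeAtMost G d = ∀ u → deg G u ≤ d

data Walk {n} (G : Graph n) : ℕ → Fin n → Fin n → Set where
  nil  : ∀ {u} → Walk G zero u u
  cons : ∀ {k u w v} → T (adj G u w) → Walk G k w v → Walk G (suc k) u v

-- dist(u,v) ≥ i+1, i.e. there is no walk (equivalently path) of length ≤ i
-- (distance is ∞ between different components)
DistAtLeast : ∀ {n} → Graph n → ℕ → Fin n → Fin n → Set
DistAtLeast G d u v = ∀ k → suc k ≤ d → ¬ Walk G k u v

IIndependent : ∀ {n} → Graph n → ℕ → (Fin n → Set) → Set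
IIndependent G i S = ∀ u v → S u → S v → u ≢ v → DistAtLeast G (suc i) u v

-- packing (1,2^10)-colouring: partition of V(G) into colour classes
-- X₀ (1-independent) and X₁,…,X₁₀ (2-independent), via a map c : V → Fin 11
PackingColoring-1-2^10 : ∀ {n} → Graph n → Set
PackingColoring-1-2^10 {n} G =
  Σ (Fin n → Fin 11) λ c →
    IIndependent G 1 (λ u → c u ≡ Data.Fin.zero) ×
    (∀ (j : Fin 10) → IIndependent G 2 (λ u → c u ≡ Data.Fin.suc j))

-- Planarity: a drawing in the plane with polygonal arcs (rational bend
-- points) pairwise meeting only in common end vertices.

Point : Set
Point = ℚ × ℚ

OnSegment : Point → Point → Point → Set
OnSegment x a b = Σ ℚ λ t → (0ℚ ≤ℚ t) × (t ≤ℚ 1ℚ) ×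
  (proj₁ x ≡ proj₁ a +ℚ t *ℚ (proj₁ b -ℚ proj₁ a)) ×
  (proj₂ x ≡ proj₂ a +ℚ t *ℚ (proj₂ b -ℚ proj₂ a))

OnPolyline : Point → List Point → Set
OnPolyline x []            = ⊥
OnPolyline x (a ∷ [])      = x ≡ a
OnPolyline x (a ∷ b ∷ ps)  = OnSegment x a b ⊎ OnPolyline x (b ∷ ps)

IsEdge : ∀ {n} → Graph n → Fin n → Fin n → Set
IsEdge G u v = T (adj G u v) × (toℕ u < toℕ v)

record PlaneDrawing {n} (G : Graph n) : Set where
  field
    pos     : Fin n → Point
    pos-inj : ∀ u v → pos u ≡ pos v → u ≡ v
    bends   : Fin n → Fin n → List Point
  curve : Fin n → Fin n → List Point
  curve u v = pos u ∷ (bends u v ++ (pos v ∷ []))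
  field
    avoids-vertices : ∀ u v w x → IsEdge G u v → OnPolyline x (curve u v) →
      x ≡ pos w → (w ≡ u) ⊎ (w ≡ v)
    edges-disjoint : ∀ u v u' v' x → IsEdge G u v → IsEdge G u' v' →
      (u ≢ u') ⊎ (v ≢ v') →
      OnPolyline x (curve u v) → OnPolyline x (curve u' v') →
      Σ (Fin n) λ w → (x ≡ pos w) × ((w ≡ u) ⊎ (w ≡ v)) × ((w ≡ u') ⊎ (w ≡ v'))

Planar : ∀ {n} → Graph n → Set
Planar G = PlaneDrawing G

-- Delete the edge uv. By minimality G − uv has a packing colouring c, and in G only pairs
-- involving u or v can violate it, so it suffices to recolour u and v. Apart from u and v,
-- every vertex within distance 2 of u is one of at most 2 + 2 + 2·3 = 10 vertices (the other
-- neighbours of u and of v, and the other neighbours of u's neighbours), so u can take one of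
-- the colours 1,…,10 unless these ten vertices carry each of them exactly once.
-- If u and v both have another neighbour of colour 0, the ten vertices around u contain two
-- zeros and so miss two colours, one of which differs from a colour missed around v.
-- Otherwise, say u has no other neighbour of colour 0: give u colour 0 and v a colour missed
-- around v; if there is none, no neighbour of v has colour 0, so give v colour 0 and u a
-- colour missed around u; if there is none either, recolour some neighbour b ≠ u of v and u
-- with 0 and give v the old colour of b, which occurs nowhere else around v.
module Submission where

open import Defs hiding (sym)
open import Data.Nat using (ℕ; zero; suc; _≤_; _<_; s≤s; z≤n)
open import Data.Nat.Properties using (≤-refl; ≤-trans; ≤-reflexive; ≤-pred; ≤⇒≯; <-cmp; +-mono-≤; +-mono-<-≤; +-mono-≤-<; +-monoʳ-<; <⇒<ᵇ)
open import Data.Nat.ListAction using (sum)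
open import Data.Fin using (Fin; zero; suc; toℕ; _≟_; _↑ˡ_; _↑ʳ_; splitAt; combine; remQuot)
open import Data.Fin.Properties using (any?; all?; ¬∀⟶∃¬; <⇒notInjective; suc-injective; 0≢1+n; toℕ-injective; splitAt-↑ˡ; remQuot-combine)
open import Data.Bool using (Bool; true; false; T; _∧_; _∨_; not)
open import Data.Bool.Properties using (∨-comm; ∧-comm; T-∧)
open import Data.List using (List; []; _∷_; length; map; filter; allFin)
open import Data.List.Properties using (filter-notAll)
open import Data.List.Relation.Unary.Any using (here; there)
import Data.List.Relation.Unary.Any as Any
open import Data.List.Membership.Propositional using (_∈_; find; lose)
open import Data.List.Membership.Propositional.Properties using (∈-filter⁺; ∈-filter⁻; ∈-allFin)
open import Data.List.Relation.Unary.Unique.Propositional using (Unique)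
open import Data.List.Relation.Unary.Unique.Propositional.Properties using (allFin⁺; filter⁺)
open import Data.List.Relation.Unary.All using (_∷_)
open import Data.List.Relation.Unary.AllPairs using (_∷_)
open import Data.Vec.Functional using (updateAt)
open import Data.Vec.Functional.Properties using (updateAt-updates; updateAt-minimal)
open import Data.Product using (∃; _×_; _,_; proj₁; proj₂; uncurry)
open import Data.Sum using (_⊎_; inj₁; inj₂; [_,_]′; map₂)
open import Data.Empty using (⊥; ⊥-elim)
open import Data.Unit using (tt)
open import Function using (_∘_; const; Equivalence)
open import Function.Definitions using (Injective)
open import Relation.Nullary using (¬_; Dec; yes; no; ¬?; does; contradiction)
open import Relation.Nullary.Decidable using (decidable-stable; T?; _×-dec_)
open import Relation.Binary using (tri<; tri≈; tri>)
open import Relation.Binary.PropositionalEquality using (_≡_; _≢_; refl; sym; trans; cong; cong₂; subst)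

open Equivalence using (to; from)

b2n-mono : ∀ {a b} → (T a → T b) → b2n a ≤ b2n b
b2n-mono {false} _         = z≤n
b2n-mono {true}  {true}  _ = ≤-refl
b2n-mono {true}  {false} f = ⊥-elim (f tt)

b2n-< : ∀ {a b} → ¬ T a → T b → b2n a < b2n b
b2n-< {false} {true}  _  _  = s≤s z≤n
b2n-< {false} {false} _  ()
b2n-< {true}          ¬a _  = ⊥-elim (¬a tt)

sum-map-mono : ∀ {A : Set} {f g : A → ℕ} → (∀ x → f x ≤ g x) →
               ∀ xs → sum (map f xs) ≤ sum (map g xs)
sum-map-mono f≤g []       = z≤n
sum-map-mono f≤g (x ∷ xs) = +-mono-≤ (f≤g x) (sum-map-mono f≤g xs)

sum-map-mono-< : ∀ {A : Set} {f g : A → ℕ} → (∀ x → f x ≤ g x) →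
                 ∀ {x xs} → x ∈ xs → f x < g x → sum (map f xs) < sum (map g xs)
sum-map-mono-< f≤g {xs = _ ∷ xs} (here refl) fx<gx = +-mono-<-≤ fx<gx (sum-map-mono f≤g xs)
sum-map-mono-< f≤g {xs = y ∷ _}  (there x∈)  fx<gx = +-mono-≤-< (f≤g y) (sum-map-mono-< f≤g x∈ fx<gx)

length-filter-T : ∀ {A : Set} (p : A → Bool) xs → length (filter (T? ∘ p) xs) ≡ sum (map (b2n ∘ p) xs)
length-filter-T p []       = refl
length-filter-T p (x ∷ xs) with p x
... | true  = cong suc (length-filter-T p xs)
... | false = length-filter-T p xs

padTo : ∀ {A : Set} → List A → A → (k : ℕ) → Fin k → A
padTo []       d k       i       = d
padTo (x ∷ xs) d (suc k) zero    = x
padTo (x ∷ xs) d (suc k) (suc i) = padTo xs d k i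

padTo-covers : ∀ {A : Set} {xs : List A} {d k x} → length xs ≤ k → x ∈ xs → ∃ λ i → padTo xs d k i ≡ x
padTo-covers {k = suc k} (s≤s _)  (here refl) = zero , refl
padTo-covers {k = suc k} (s≤s xs≤k) (there x∈) = let (i , e) = padTo-covers xs≤k x∈ in suc i , e

unique-constant⇒length≤1 : ∀ {A : Set} {e : A} xs → Unique xs → (∀ {z} → z ∈ xs → z ≡ e) → length xs ≤ 1
unique-constant⇒length≤1 []           _                 _   = z≤n
unique-constant⇒length≤1 (_ ∷ [])     _                 _   = s≤s z≤n
unique-constant⇒length≤1 (_ ∷ _ ∷ _) ((y≢y′ ∷ _) ∷ _) all≡ =
  ⊥-elim (y≢y′ (trans (all≡ (here refl)) (sym (all≡ (there (here refl))))))

injective⇒onto : ∀ {k} (s : Fin k → Fin k) → Injective _≡_ _≡_ s → ∀ p → ∃ λ j → s j ≡ p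
injective⇒onto {k} s s-injective p with any? (λ j → s j ≟ p)
... | yes hit = hit
... | no  miss = ⊥-elim (<⇒notInjective ≤-refl (λ {i} {j} → extend-injective {i} {j}))
  where
  extend : Fin (suc k) → Fin k
  extend zero    = p
  extend (suc j) = s j
  extend-injective : Injective _≡_ _≡_ extend
  extend-injective {zero}  {zero}  _ = refl
  extend-injective {zero}  {suc j} e = contradiction (j , sym e) miss
  extend-injective {suc i} {zero}  e = contradiction (i , e) miss
  extend-injective {suc i} {suc j} e = cong suc (s-injective e)

-- A map h : Fin k → Fin (suc k) is read as a colouring of k slots with colours 0,…,k.
module _ {k} (h : Fin k → Fin (suc k)) where

  Saturated : Set
  Saturated = ∀ j → ∃ λ i → h i ≡ suc j

  Misses : Fin k → Set
  Misses j = ∀ i → h i ≢ suc j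

  misses? : ∀ j → Dec (Misses j)
  misses? j = all? (λ i → ¬? (h i ≟ suc j))

  ¬misses⇒hit : ∀ {j} → ¬ Misses j → ∃ λ i → h i ≡ suc j
  ¬misses⇒hit {j} ¬miss =
    let (i , ¬≢) = ¬∀⟶∃¬ k _ (λ i → ¬? (h i ≟ suc j)) ¬miss in i , decidable-stable (h i ≟ suc j) ¬≢

  saturated⊎misses : Saturated ⊎ ∃ Misses
  saturated⊎misses with any? misses?
  ... | yes miss = inj₂ miss
  ... | no ¬miss = inj₁ (λ j → ¬misses⇒hit (λ miss → ¬miss (j , miss)))

  module _ (saturated : Saturated) where

    saturated⇒onto : ∀ p → ∃ λ j → proj₁ (saturated j) ≡ p
    saturated⇒onto = injective⇒onto (proj₁ ∘ saturated) λ {i} {j} e →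
      suc-injective (trans (sym (proj₂ (saturated i))) (trans (cong h e) (proj₂ (saturated j))))

    saturated⇒nonzero : ∀ p → h p ≢ zero
    saturated⇒nonzero p hp with saturated⇒onto p
    ... | j , refl = 0≢1+n (trans (sym hp) (proj₂ (saturated j)))

    saturated⇒injective : Injective _≡_ _≡_ h
    saturated⇒injective {p} {q} e with saturated⇒onto p | saturated⇒onto q
    ... | i , refl | j , refl =
      cong (proj₁ ∘ saturated) (suc-injective (trans (sym (proj₂ (saturated i))) (trans e (proj₂ (saturated j)))))

  zero⇒misses : ∀ {p} → h p ≡ zero → ∃ Misses
  zero⇒misses {p} hp with saturated⊎misses
  ... | inj₁ saturated = ⊥-elim (saturated⇒nonzero saturated p hp)
  ... | inj₂ miss      = miss

-- Otherwise recolouring q with j₀ would saturate h while p still has colour 0.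
two-zeros⇒misses-other : ∀ {k} (h : Fin k → Fin (suc k)) {p q} → h p ≡ zero → h q ≡ zero → p ≢ q →
                         ∀ j₀ → ∃ λ j → j ≢ j₀ × Misses h j
two-zeros⇒misses-other h {p} {q} hp hq p≢q j₀ with any? (λ j → ¬? (j ≟ j₀) ×-dec misses? h j)
... | yes found = found
... | no ¬found = ⊥-elim (saturated⇒nonzero h′ saturated p (trans (updateAt-minimal p q h p≢q) hp))
  where
  h′ : Fin _ → Fin _
  h′ = updateAt h q (const (suc j₀))
  saturated : Saturated h′
  saturated j with j ≟ j₀
  ... | yes refl = q , updateAt-updates q h
  ... | no j≢j₀  =
    let (i , hi) = ¬misses⇒hit h (λ miss → ¬found (j , j≢j₀ , miss))
        i≢q : i ≢ q
        i≢q i≡q = 0≢1+n (trans (sym hq) (trans (cong h (sym i≡q)) hi))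
    in i , trans (updateAt-minimal i q h i≢q) hi

module _ {n} (G : Graph n) where

  Adj : Fin n → Fin n → Set
  Adj x y = T (adj G x y)

  Adj² : Fin n → Fin n → Set
  Adj² x z = ∃ λ m → Adj x m × Adj m z

  Dist≤2 : Fin n → Fin n → Set
  Dist≤2 x z = Adj x z ⊎ Adj² x z

  adj-sym : ∀ {x y} → Adj x y → Adj y x
  adj-sym {x} {y} = subst T (Graph.sym G x y)

  adj-irrefl : ∀ {x y} → Adj x y → x ≢ y
  adj-irrefl {x} xx refl = subst T (Graph.irrefl G x) xx

  neighbours : Fin n → List (Fin n)
  neighbours w = filter (T? ∘ adj G w) (allFin n)

  ∈-neighbours : ∀ {w z} → Adj w z → z ∈ neighbours w
  ∈-neighbours {w} wz = ∈-filter⁺ (T? ∘ adj G w) (∈-allFin _) wz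

  length-neighbours : ∀ w → length (neighbours w) ≡ deg G w
  length-neighbours w = length-filter-T (adj G w) (allFin n)

  other-neighbour : ∀ {w} e → 1 < deg G w → ∃ λ b → Adj w b × b ≢ e
  other-neighbour {w} e 1<deg with Any.any? (¬? ∘ (_≟ e)) (neighbours w)
  ... | yes found =
    let (b , b∈ , b≢e) = find found in b , proj₂ (∈-filter⁻ (T? ∘ adj G w) {xs = allFin n} b∈) , b≢e
  ... | no ¬found = contradiction 1<deg (≤⇒≯ (subst (_≤ 1) (length-neighbours w) length≤1))
    where
    length≤1 : length (neighbours w) ≤ 1
    length≤1 = unique-constant⇒length≤1 (neighbours w) (filter⁺ (T? ∘ adj G w) (allFin⁺ n))
                 λ {z} z∈ → decidable-stable (z ≟ e) (λ z≢e → ¬found (lose z∈ z≢e))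

  -- Slots left over after the neighbours other than e hold w itself.
  otherNeighbour : Fin n → Fin n → (k : ℕ) → Fin k → Fin n
  otherNeighbour w e = padTo (filter (¬? ∘ (_≟ e)) (neighbours w)) w

  otherNeighbour-covers : ∀ {w e k z} → deg G w ≤ suc k → Adj w e → Adj w z → z ≢ e →
                          ∃ λ i → otherNeighbour w e k i ≡ z
  otherNeighbour-covers {w} {e} deg≤ we wz z≢e =
    padTo-covers (≤-pred (≤-trans fewer (≤-trans (≤-reflexive (length-neighbours w)) deg≤)))
                 (∈-filter⁺ (¬? ∘ (_≟ e)) (∈-neighbours wz) z≢e)
    where
    fewer : length (filter (¬? ∘ (_≟ e)) (neighbours w)) < length (neighbours w)
    fewer = filter-notAll (¬? ∘ (_≟ e)) (neighbours w) (Any.map (λ z≡e z≢e → z≢e (sym z≡e)) (∈-neighbours we))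

  -- Colour 0 is a 1-independent class and every other colour a 2-independent one, so a
  -- vertex x of colour α excludes α from exactly the vertices z with Within α x z.
  Within : Fin 11 → Fin n → Fin n → Set
  Within α x z = Adj x z ⊎ (α ≢ zero × Adj² x z)

  within-sym : ∀ {α x z} → Within α x z → Within α z x
  within-sym (inj₁ xz)                  = inj₁ (adj-sym xz)
  within-sym (inj₂ (α≢0 , m , xm , mz)) = inj₂ (α≢0 , m , adj-sym mz , adj-sym xm)

  within-zero : ∀ {x z} → Within zero x z → Adj x z
  within-zero (inj₁ xz)       = xz
  within-zero (inj₂ (0≢0 , _)) = ⊥-elim (0≢0 refl)

  within⇒dist≤2 : ∀ {α x z} → Within α x z → Dist≤2 x z
  within⇒dist≤2 = map₂ proj₂

  SeparatedAt : (Fin n → Fin 11) → Fin n → Set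
  SeparatedAt c x = ∀ z → x ≢ z → Within (c x) x z → c x ≢ c z

  Proper : (Fin n → Fin 11) → Set
  Proper c = ∀ x → SeparatedAt c x

  ProperAway : Fin n → Fin n → (Fin n → Fin 11) → Set
  ProperAway u v c = ∀ {x z} → x ≢ u → x ≢ v → z ≢ u → z ≢ v → x ≢ z → Within (c x) x z → c x ≢ c z

  Admissible : (Fin n → Fin 11) → Fin n → Fin n → Fin 11 → Set
  Admissible c u v α = ∀ z → z ≢ u → z ≢ v → Within α u z → c z ≢ α

  proper⇒packing : ∀ {c} → Proper c → PackingColoring-1-2^10 G
  proper⇒packing {c} proper = c , class₀ , class₊
    where
    clash : ∀ {x z} → x ≢ z → c x ≡ c z → Within (c x) x z → ⊥
    clash {x} {z} x≢z e w = proper x z x≢z w e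
    class₀ : IIndependent G 1 (λ x → c x ≡ zero)
    class₀ x z cx cz x≢z 0 _ nil = x≢z refl
    class₀ x z cx cz x≢z 1 _ (cons xz nil) = clash x≢z (trans cx (sym cz)) (inj₁ xz)
    class₀ x z cx cz x≢z (suc (suc _)) (s≤s (s≤s ())) _
    class₊ : ∀ j → IIndependent G 2 (λ x → c x ≡ suc j)
    class₊ j x z cx cz x≢z 0 _ nil = x≢z refl
    class₊ j x z cx cz x≢z 1 _ (cons xz nil) = clash x≢z (trans cx (sym cz)) (inj₁ xz)
    class₊ j x z cx cz x≢z 2 _ (cons xm (cons mz nil)) =
      clash x≢z (trans cx (sym cz)) (inj₂ ((λ cx≡0 → 0≢1+n (trans (sym cx≡0) cx)) , _ , xm , mz))
    class₊ j x z cx cz x≢z (suc (suc (suc _))) (s≤s (s≤s (s≤s ()))) _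

  packing⇒proper : (packing : PackingColoring-1-2^10 G) → Proper (proj₁ packing)
  packing⇒proper (c , class₀ , class₊) x z x≢z (inj₁ xz) cx≡cz with c x in cx
  ... | zero  = class₀ x z cx (sym cx≡cz) x≢z 1 ≤-refl (cons xz nil)
  ... | suc j = class₊ j x z cx (sym cx≡cz) x≢z 1 (s≤s (s≤s z≤n)) (cons xz nil)
  packing⇒proper (c , class₀ , class₊) x z x≢z (inj₂ (cx≢0 , _ , xm , mz)) cx≡cz with c x in cx
  ... | zero  = cx≢0 refl
  ... | suc j = class₊ j x z cx (sym cx≡cz) x≢z 2 ≤-refl (cons xm (cons mz nil))

  separated-toward : ∀ {c x z} → SeparatedAt c z → x ≢ z → Within (c x) x z → c x ≢ c z
  separated-toward {c} {x} {z} separated x≢z w e =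
    separated x (x≢z ∘ sym) (subst (λ α → Within α z x) e (within-sym w)) (sym e)

  properAway⇒proper : ∀ {u v c} → ProperAway u v c → SeparatedAt c u → SeparatedAt c v → Proper c
  properAway⇒proper {u} {v} away separatedᵤ separatedᵥ x z x≢z w with x ≟ u | x ≟ v
  ... | yes refl | _        = separatedᵤ z x≢z w
  ... | no _     | yes refl = separatedᵥ z x≢z w
  ... | no x≢u   | no x≢v with z ≟ u | z ≟ v
  ...   | yes refl | _        = separated-toward separatedᵤ x≢z w
  ...   | no _     | yes refl = separated-toward separatedᵥ x≢z w
  ...   | no z≢u   | no z≢v   = away x≢u x≢v z≢u z≢v x≢z w

  properAway-swap : ∀ {u v c} → ProperAway u v c → ProperAway v u c
  properAway-swap away x≢v x≢u z≢v z≢u = away x≢u x≢v z≢u z≢v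

  recolour-pair : ∀ {u v α β c} → ProperAway u v c → u ≢ v → α ≢ β →
                  Admissible c u v α → Admissible c v u β → PackingColoring-1-2^10 G
  recolour-pair {u} {v} {α} {β} {c} away u≢v α≢β admissibleᵤ admissibleᵥ =
    proper⇒packing (properAway⇒proper away′ (separated c′u c′v α≢β c′-away admissibleᵤ)
                                             (separated c′v c′u (α≢β ∘ sym) (λ z≢v z≢u → c′-away z≢u z≢v) admissibleᵥ))
    where
    c′ : Fin n → Fin 11
    c′ = updateAt (updateAt c u (const α)) v (const β)
    c′v : c′ v ≡ β
    c′v = updateAt-updates v _
    c′u : c′ u ≡ α
    c′u = trans (updateAt-minimal u v _ u≢v) (updateAt-updates u c)
    c′-away : ∀ {z} → z ≢ u → z ≢ v → c′ z ≡ c z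
    c′-away z≢u z≢v = trans (updateAt-minimal _ v _ z≢v) (updateAt-minimal _ u c z≢u)
    away′ : ProperAway u v c′
    away′ x≢u x≢v z≢u z≢v x≢z w e =
      away x≢u x≢v z≢u z≢v x≢z (subst (λ γ → Within γ _ _) (c′-away x≢u x≢v) w)
           (trans (sym (c′-away x≢u x≢v)) (trans e (c′-away z≢u z≢v)))
    separated : ∀ {x y γ δ} → c′ x ≡ γ → c′ y ≡ δ → γ ≢ δ → (∀ {z} → z ≢ x → z ≢ y → c′ z ≡ c z) →
                Admissible c x y γ → SeparatedAt c′ x
    separated {x} {y} c′x c′y γ≢δ unchanged admissible z x≢z w e with z ≟ y
    ... | yes refl = γ≢δ (trans (sym c′x) (trans e c′y))
    ... | no z≢y   = admissible z (x≢z ∘ sym) z≢y (subst (λ γ → Within γ x z) c′x w)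
                       (trans (sym (unchanged (x≢z ∘ sym) z≢y)) (trans (sym e) c′x))

  properAway-zero : ∀ {u v c b} → ProperAway u v c → (∀ {z} → Adj b z → z ≢ u → z ≢ v → c z ≢ zero) →
                    ProperAway u v (updateAt c b (const zero))
  properAway-zero {u} {v} {c} {b} away nonzero {x} {z} x≢u x≢v z≢u z≢v x≢z w e with x ≟ b | z ≟ b
  ... | yes refl | _        =
    nonzero (within-zero (subst (λ γ → Within γ x z) (updateAt-updates _ c) w)) z≢u z≢v
            (trans (sym (updateAt-minimal z x c (x≢z ∘ sym))) (trans (sym e) (updateAt-updates _ c)))
  ... | no x≢b   | yes refl =
    nonzero (adj-sym (within-zero (subst (λ γ → Within γ x z) (trans e (updateAt-updates _ c)) w))) x≢u x≢v
            (trans (sym (updateAt-minimal x z c x≢b)) (trans e (updateAt-updates _ c)))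
  ... | no x≢b   | no z≢b   =
    away x≢u x≢v z≢u z≢v x≢z (subst (λ γ → Within γ x z) (updateAt-minimal x b c x≢b) w)
         (trans (sym (updateAt-minimal x b c x≢b)) (trans e (updateAt-minimal z b c z≢b)))

_⊆ᴳ_ : ∀ {n} → Graph n → Graph n → Set
H ⊆ᴳ G = ∀ a b → Adj H a b → Adj G a b

deg-mono : ∀ {n} {H G : Graph n} → H ⊆ᴳ G → ∀ w → deg H w ≤ deg G w
deg-mono {n} H⊆G w = sum-map-mono (λ z → b2n-mono (H⊆G w z)) (allFin n)

maxDegree-mono : ∀ {n d} {H G : Graph n} → H ⊆ᴳ G → MaxDegreeAtMost G d → MaxDegreeAtMost H d
maxDegree-mono {H = H} {G} H⊆G Δ≤d w = ≤-trans (deg-mono {H = H} {G} H⊆G w) (Δ≤d w)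

planar-mono : ∀ {n} {H G : Graph n} → H ⊆ᴳ G → Planar G → Planar H
planar-mono H⊆G D = record
  { pos             = PlaneDrawing.pos D
  ; pos-inj         = PlaneDrawing.pos-inj D
  ; bends           = PlaneDrawing.bends D
  ; avoids-vertices = λ a b w x (ab , a<b) → PlaneDrawing.avoids-vertices D a b w x (H⊆G a b ab , a<b)
  ; edges-disjoint  = λ a b a′ b′ x (ab , a<b) (ab′ , a<b′) →
      PlaneDrawing.edges-disjoint D a b a′ b′ x (H⊆G a b ab , a<b) (H⊆G a′ b′ ab′ , a<b′)
  }

numEdges-<-ordered : ∀ {n} {H G : Graph n} → H ⊆ᴳ G → ∀ {p q} → toℕ p < toℕ q →
                     Adj G p q → ¬ Adj H p q → numEdges H < numEdges G
numEdges-<-ordered {n} {H} {G} H⊆G {p} {q} p<q pq ¬pq =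
  sum-map-mono-< (λ a → sum-map-mono (entry-≤ a) (allFin n)) (∈-allFin p)
    (sum-map-mono-< (entry-≤ p) (∈-allFin q)
      (b2n-< (¬pq ∘ proj₁ ∘ to (T-∧ {adj H p q})) (from T-∧ (pq , <⇒<ᵇ p<q))))
  where
  entry-≤ : ∀ a b → b2n (adj H a b ∧ (a <ᵇF b)) ≤ b2n (adj G a b ∧ (a <ᵇF b))
  entry-≤ a b = b2n-mono λ t → let (ab , a<b) = to (T-∧ {adj H a b}) t in from T-∧ (H⊆G a b ab , a<b)

numEdges-< : ∀ {n} {H G : Graph n} → H ⊆ᴳ G → ∀ {p q} → Adj G p q → ¬ Adj H p q → numEdges H < numEdges G
numEdges-< {H = H} {G} H⊆G {p} {q} pq ¬pq with <-cmp (toℕ p) (toℕ q)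
... | tri< p<q _ _ = numEdges-<-ordered {H = H} {G} H⊆G p<q pq ¬pq
... | tri≈ _ p≡q _ = ⊥-elim (adj-irrefl G pq (toℕ-injective p≡q))
... | tri> _ _ q<p = numEdges-<-ordered {H = H} {G} H⊆G q<p (adj-sym G pq) (¬pq ∘ adj-sym H)

samePair : ∀ {n} → Fin n → Fin n → Fin n → Fin n → Bool
samePair u v a b = (does (a ≟ u) ∧ does (b ≟ v)) ∨ (does (a ≟ v) ∧ does (b ≟ u))

samePair-sym : ∀ {n} (u v a b : Fin n) → samePair u v a b ≡ samePair u v b a
samePair-sym u v a b = trans (∨-comm (does (a ≟ u) ∧ does (b ≟ v)) _) (cong₂ _∨_ (∧-comm (does (a ≟ v)) _) (∧-comm (does (a ≟ u)) _))

removeEdge : ∀ {n} → Graph n → Fin n → Fin n → Graph n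
removeEdge G u v = record
  { adj    = λ a b → adj G a b ∧ not (samePair u v a b)
  ; sym    = λ a b → cong₂ _∧_ (Graph.sym G a b) (cong not (samePair-sym u v a b))
  ; irrefl = λ a → cong (_∧ not (samePair u v a a)) (Graph.irrefl G a)
  }

module _ {n} (G : Graph n) {u v : Fin n} where

  removeEdge-⊆ : removeEdge G u v ⊆ᴳ G
  removeEdge-⊆ a b = proj₁ ∘ to (T-∧ {adj G a b})

  removeEdge-removes : ¬ Adj (removeEdge G u v) u v
  removeEdge-removes uv with u ≟ u | v ≟ v | proj₂ (to (T-∧ {adj G u v}) uv)
  ... | yes _ | yes _ | ()
  ... | no u≢u | _    | _ = u≢u refl
  ... | _ | no v≢v    | _ = v≢v refl

  removeEdge-keeps : ∀ {a b} → a ≢ u → a ≢ v → Adj G a b → Adj (removeEdge G u v) a b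
  removeEdge-keeps {a} a≢u a≢v ab with a ≟ u | a ≟ v
  ... | yes a≡u | _       = ⊥-elim (a≢u a≡u)
  ... | no _    | yes a≡v = ⊥-elim (a≢v a≡v)
  ... | no _    | no _    = from T-∧ (ab , tt)

  within-removeEdge : ∀ {α x z} → x ≢ u → x ≢ v → z ≢ u → z ≢ v → Within G α x z → Within (removeEdge G u v) α x z
  within-removeEdge x≢u x≢v _ _ (inj₁ xz) = inj₁ (removeEdge-keeps x≢u x≢v xz)
  within-removeEdge x≢u x≢v z≢u z≢v (inj₂ (α≢0 , m , xm , mz)) =
    inj₂ (α≢0 , m , removeEdge-keeps x≢u x≢v xm , adj-sym (removeEdge G u v) (removeEdge-keeps z≢u z≢v (adj-sym G mz)))

  proper-removeEdge⇒properAway : ∀ {c} → Proper (removeEdge G u v) c → ProperAway G u v c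
  proper-removeEdge⇒properAway proper x≢u x≢v z≢u z≢v x≢z w =
    proper _ _ x≢z (within-removeEdge x≢u x≢v z≢u z≢v w)

  size-removeEdge : Adj G u v → size (removeEdge G u v) < size G
  size-removeEdge uv = +-monoʳ-< n (numEdges-< {H = removeEdge G u v} {G} removeEdge-⊆ uv removeEdge-removes)

  planar-removeEdge : Planar G → Planar (removeEdge G u v)
  planar-removeEdge = planar-mono removeEdge-⊆

  maxDegree-removeEdge : ∀ {d} → MaxDegreeAtMost G d → MaxDegreeAtMost (removeEdge G u v) d
  maxDegree-removeEdge = maxDegree-mono {H = removeEdge G u v} {G} removeEdge-⊆

-- Slots 0–1: the neighbours of u other than v; slots 2–3: those of v other than u;
-- slots 4–9: for each of the first two, its neighbours other than u.
module Ball {n} (G : Graph n) (Δ≤4 : MaxDegreeAtMost G 4) {u v} (uv : Adj G u v)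
            (deg-u≤3 : deg G u ≤ 3) (deg-v≤3 : deg G v ≤ 3) where

  near : Fin 2 → Fin n
  near = otherNeighbour G u v 2

  across : Fin 2 → Fin n
  across = otherNeighbour G v u 2

  far : Fin 2 → Fin 3 → Fin n
  far a = otherNeighbour G (near a) u 3

  beyond : Fin 8 → Fin n
  beyond = [ across , uncurry far ∘ remQuot 3 ]′ ∘ splitAt 2

  ball : Fin 10 → Fin n
  ball = [ near , beyond ]′ ∘ splitAt 2

  nearSlot : Fin 2 → Fin 10
  nearSlot a = a ↑ˡ 8

  acrossSlot : Fin 2 → Fin 10
  acrossSlot b = 2 ↑ʳ (b ↑ˡ 6)

  farSlot : Fin 2 → Fin 3 → Fin 10
  farSlot a c = 2 ↑ʳ 2 ↑ʳ combine a c

  ball-near : ∀ a → ball (nearSlot a) ≡ near a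
  ball-near a = cong [ near , beyond ]′ (splitAt-↑ˡ 2 a 8)

  ball-across : ∀ b → ball (acrossSlot b) ≡ across b
  ball-across b = cong [ across , uncurry far ∘ remQuot 3 ]′ (splitAt-↑ˡ 2 b 6)

  ball-far : ∀ a c → ball (farSlot a c) ≡ far a c
  ball-far a c = cong (uncurry far) (remQuot-combine a c)

  nearSlot≢acrossSlot : ∀ a b → nearSlot a ≢ acrossSlot b
  nearSlot≢acrossSlot a b e with trans (sym (splitAt-↑ˡ 2 a 8)) (cong (splitAt 2) e)
  ... | ()

  ball-covers : ∀ {z} → z ≢ u → z ≢ v → Dist≤2 G u z → ∃ λ i → ball i ≡ z
  ball-covers z≢u z≢v (inj₁ uz) =
    let (a , e) = otherNeighbour-covers G deg-u≤3 uv uz z≢v in nearSlot a , trans (ball-near a) e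
  ball-covers z≢u z≢v (inj₂ (m , um , mz)) with m ≟ v
  ... | yes refl =
    let (b , e) = otherNeighbour-covers G deg-v≤3 (adj-sym G uv) mz z≢u in acrossSlot b , trans (ball-across b) e
  ... | no m≢v with otherNeighbour-covers G deg-u≤3 uv um m≢v
  ...   | a , refl =
    let (c , e) = otherNeighbour-covers G (Δ≤4 (near a)) (adj-sym G um) mz z≢u in farSlot a c , trans (ball-far a c) e

  misses⇒admissible : ∀ {c j} → Misses (c ∘ ball) j → Admissible G c u v (suc j)
  misses⇒admissible {c} miss z z≢u z≢v w cz =
    let (i , e) = ball-covers z≢u z≢v (within⇒dist≤2 G w) in miss i (trans (cong c e) cz)

  near-nonzero⇒admissible : ∀ {c} → (∀ a → c (near a) ≢ zero) → Admissible G c u v zero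
  near-nonzero⇒admissible {c} nonzero z z≢u z≢v w cz =
    let (a , e) = otherNeighbour-covers G deg-u≤3 uv (within-zero G w) z≢v in nonzero a (trans (cong c e) cz)

  saturated⇒nonzero-within : ∀ {c z} → Saturated (c ∘ ball) → z ≢ u → z ≢ v → Dist≤2 G u z → c z ≢ zero
  saturated⇒nonzero-within {c} saturated z≢u z≢v uz =
    let (i , e) = ball-covers z≢u z≢v uz in saturated⇒nonzero (c ∘ ball) saturated i ∘ trans (cong c e)

  saturated⇒admissible : ∀ {c} → Saturated (c ∘ ball) → Admissible G c u v zero
  saturated⇒admissible saturated z z≢u z≢v w = saturated⇒nonzero-within saturated z≢u z≢v (inj₁ (within-zero G w))

module Recolour {n} (G : Graph n) (Δ≤4 : MaxDegreeAtMost G 4) {u v} (uv : Adj G u v)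
                (deg-u≡3 : deg G u ≡ 3) (deg-v≡3 : deg G v ≡ 3) (c : Fin n → Fin 11) (away : ProperAway G u v c) where

  module U = Ball G Δ≤4 uv (≤-reflexive deg-u≡3) (≤-reflexive deg-v≡3)
  module V = Ball G Δ≤4 (adj-sym G uv) (≤-reflexive deg-v≡3) (≤-reflexive deg-u≡3)

  u≢v : u ≢ v
  u≢v = adj-irrefl G uv

  zero-near-both : ∀ {a b} → c (U.near a) ≡ zero → c (V.near b) ≡ zero → PackingColoring-1-2^10 G
  zero-near-both {a} {b} ca cb =
    let (jᵥ , missᵥ) = zero⇒misses (c ∘ V.ball) {V.nearSlot b} (trans (cong c (V.ball-near b)) cb)
        (jᵤ , jᵤ≢jᵥ , missᵤ) = two-zeros⇒misses-other (c ∘ U.ball) (trans (cong c (U.ball-near a)) ca)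
                                 (trans (cong c (U.ball-across b)) cb) (U.nearSlot≢acrossSlot a b) jᵥ
    in recolour-pair G away u≢v (jᵤ≢jᵥ ∘ suc-injective) (U.misses⇒admissible missᵤ) (V.misses⇒admissible missᵥ)

  saturated-both : Saturated (c ∘ U.ball) → Saturated (c ∘ V.ball) → PackingColoring-1-2^10 G
  saturated-both saturatedᵤ saturatedᵥ with other-neighbour G u (subst (1 <_) (sym deg-v≡3) (s≤s (s≤s z≤n)))
  ... | b , vb , b≢u = recolour-pair G away₀ u≢v (cb≢0 ∘ sym) admissibleᵤ admissibleᵥ
    where
    b≢v : b ≢ v
    b≢v = adj-irrefl G vb ∘ sym

    ballᵥ-injective : ∀ {p q} → c (V.ball p) ≡ c (V.ball q) → p ≡ q
    ballᵥ-injective = saturated⇒injective (c ∘ V.ball) saturatedᵥ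

    b-slot : ∃ λ p → V.ball p ≡ b
    b-slot = V.ball-covers b≢v b≢u (inj₁ vb)

    cb≢0 : c b ≢ zero
    cb≢0 = V.saturated⇒nonzero-within saturatedᵥ b≢v b≢u (inj₁ vb)

    c₀ : Fin n → Fin 11
    c₀ = updateAt c b (const zero)

    away₀ : ProperAway G u v c₀
    away₀ = properAway-zero G away λ bz z≢u z≢v → V.saturated⇒nonzero-within saturatedᵥ z≢v z≢u (inj₂ (b , vb , bz))

    -- b would fill a slot of v's ball both as a neighbour of v and as one of u.
    ¬ub : ¬ Adj G u b
    ¬ub ub =
      let (a , ea) = otherNeighbour-covers G (≤-reflexive deg-u≡3) uv ub b≢v
          (a′ , ea′) = otherNeighbour-covers G (≤-reflexive deg-v≡3) (adj-sym G uv) vb b≢u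
          same = ballᵥ-injective (cong c (trans (V.ball-near a′) (trans ea′ (sym (trans (V.ball-across a) ea)))))
      in V.nearSlot≢acrossSlot a′ a same

    admissibleᵤ : Admissible G c₀ u v zero
    admissibleᵤ z z≢u z≢v w with z ≟ b
    ... | yes refl = ⊥-elim (¬ub (within-zero G w))
    ... | no z≢b   = U.saturated⇒admissible saturatedᵤ z z≢u z≢v w ∘ trans (sym (updateAt-minimal z b c z≢b))

    admissibleᵥ : Admissible G c₀ v u (c b)
    admissibleᵥ z z≢v z≢u w with z ≟ b
    ... | yes refl = λ e → cb≢0 (trans (sym e) (updateAt-updates z c))
    ... | no z≢b   = λ e →
      let (p , ep) = V.ball-covers z≢v z≢u (within⇒dist≤2 G w)
          (q , eq) = b-slot
          p≡q = ballᵥ-injective {p} {q} (trans (cong c ep) (trans (trans (sym (updateAt-minimal z b c z≢b)) e) (cong c (sym eq))))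
      in z≢b (trans (sym ep) (trans (cong V.ball p≡q) eq))

  no-zero-near : (∀ a → c (U.near a) ≢ zero) → PackingColoring-1-2^10 G
  no-zero-near nonzero with saturated⊎misses (c ∘ V.ball)
  ... | inj₂ (j , miss) = recolour-pair G away u≢v (λ ()) (U.near-nonzero⇒admissible nonzero) (V.misses⇒admissible miss)
  ... | inj₁ saturatedᵥ with saturated⊎misses (c ∘ U.ball)
  ...   | inj₂ (j , miss) = recolour-pair G away u≢v (λ ()) (U.misses⇒admissible miss) (V.saturated⇒admissible saturatedᵥ)
  ...   | inj₁ saturatedᵤ = saturated-both saturatedᵤ saturatedᵥ

module _ {n} (G : Graph n) (Δ≤4 : MaxDegreeAtMost G 4) {u v} (uv : Adj G u v)
         (deg-u≡3 : deg G u ≡ 3) (deg-v≡3 : deg G v ≡ 3) (c : Fin n → Fin 11) (away : ProperAway G u v c) where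

  private
    module UV = Recolour G Δ≤4 uv deg-u≡3 deg-v≡3 c away
    module VU = Recolour G Δ≤4 (adj-sym G uv) deg-v≡3 deg-u≡3 c (properAway-swap G away)

  repair : PackingColoring-1-2^10 G
  repair with any? (λ a → c (UV.U.near a) ≟ zero) | any? (λ b → c (UV.V.near b) ≟ zero)
  ... | yes (a , ca) | yes (b , cb) = UV.zero-near-both ca cb
  ... | no ¬zeroᵤ    | _            = UV.no-zero-near (λ a ca → ¬zeroᵤ (a , ca))
  ... | _            | no ¬zeroᵥ    = VU.no-zero-near (λ b cb → ¬zeroᵥ (b , cb))

lemma2p2 : ∀ {n} (G : Graph n) → Planar G → MaxDegreeAtMost G 4 →
    ¬ PackingColoring-1-2^10 G →
    (∀ {m} (H : Graph m) → size H < size G → Planar H → MaxDegreeAtMost H 4 →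
      ¬ ¬ PackingColoring-1-2^10 H) →
    ∀ u v → T (adj G u v) → deg G u ≡ 3 → deg G v ≡ 3 → ⊥
lemma2p2 G planar Δ≤4 uncolourable minimal u v uv deg-u≡3 deg-v≡3 =
  minimal (removeEdge G u v) (size-removeEdge G uv) (planar-removeEdge G planar) (maxDegree-removeEdge G Δ≤4)
          λ packing → uncolourable (repair G Δ≤4 uv deg-u≡3 deg-v≡3 (proj₁ packing)
                                      (proper-removeEdge⇒properAway G (packing⇒proper (removeEdge G u v) packing)))
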